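{- Let $n\ge2$ be an integer and let $I$ be a set of $3n$ consecutive positive integers, all greater than $2n+2$. Then $|I\cap U(1,n)|\le n+1$.
   Context: For an integer $n\ge2$, $U(1,n)$ is the Ulam sequence: the increasing sequence with first terms $1,n$, each subsequent term being the smallest integer larger than the previous term that is a sum $u+v$ of two earlier terms $u<v$ in exactly one way; it is identified with its set of terms. -}

module Defs where

open import Data.Nat using (ℕ; zero; suc; _+_; _*_; _∸_; _<ᵇ_; _≡ᵇ_)
open import Data.Bool using (Bool; true; false; if_then_else_; _∧_; _∨_; not)
open import Data.List using (List; []; _∷_; _++_; length; filterᵇ; map; upTo)
open import Data.Bool.ListAction using (any)

memᵇ : ℕ → List ℕ → Bool
memᵇ k xs = any (λ x → x ≡ᵇ k) xs

-- Number of ways to write k = u + v with u < v, u and v both in the list xs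
-- (xs is a list of distinct naturals; each unordered pair counted once,
-- indexed by its smaller element u).
reps : List ℕ → ℕ → ℕ
reps xs k = length (filterᵇ (λ u → (u <ᵇ (k ∸ u)) ∧ memᵇ (k ∸ u) xs) xs)

-- A number k is a term iff k = 1, or k = n, or k > n and k has exactly one
-- representation u + v (u < v) with u, v earlier terms (i.e. terms < k).
-- (This is the standard equivalent unfolding of the greedy definition:
--  since terms are produced in increasing order, the next term is the
--  smallest k > previous term with a unique representation.)
-- One step: given n, the previous list prev (terms ≤ m) and k = m + 1,
-- append k if it is a term.
isNewTerm : ℕ → List ℕ → ℕ → Bool
isNewTerm n prev k = (k ≡ᵇ 1) ∨ (k ≡ᵇ n) ∨ ((n <ᵇ k) ∧ (reps prev k ≡ᵇ 1))

step : ℕ → List ℕ → ℕ → List ℕ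
step n prev k = if isNewTerm n prev k then prev ++ (k ∷ []) else prev

ulamUpTo : ℕ → ℕ → List ℕ
ulamUpTo n zero = []
ulamUpTo n (suc m) = step n (ulamUpTo n m) (suc m)

isUlam : ℕ → ℕ → Bool
isUlam n k = memᵇ k (ulamUpTo n k)

countUlamIn : ℕ → ℕ → ℕ → ℕ
countUlamIn n a len = length (filterᵇ (isUlam n) (map (a +_) (upTo len)))

module Submission where

-- Call x a window point of y when y − x ∈ {1} ∪ [n, 2n].  The proof separates
-- a combinatorial core from the arithmetic of U(1, n).
--
-- Say S is n-sparse above a when, for
--   every y ∈ S, at most one x ≥ a in S is a window point of y.  Then S has at
--   most n + 1 points in [a, a + 3n): let y be the largest one and a₁ the least
--   point of S in (y − n, y].  Every point of S in [a, y] lies in [a, a₁ − 2n),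
--   or is the window point of a₁ or of y, or lies in [a₁, y − 1), or equals y;
--   counting these pieces gives at most (a₁ − 2n − a) + (y − a₁ + 1) + 1.
-- * Arithmetic.  The gaps 1, n, …, 2n are themselves terms of U(1, n).  So two
--   terms x₁ ≠ x₂ above 2n in the window of a term y give two representations
--   y = (y − xᵢ) + xᵢ by earlier terms, contradicting uniqueness: the terms
--   above 2n form an n-sparse set.
--
-- Counting is done on intervals [u, u + L) for decidable predicates, and is
-- finally identified with the list-based countUlamIn of the statement.

open import Defs
open import Data.Nat using (ℕ; _+_; _*_; _≤_; _<_)
open import Data.Nat using (zero; suc; _∸_; z≤n; s≤s; _<ᵇ_; _≡ᵇ_)
open import Data.Nat.Properties
open import Data.Nat.Induction using (<-rec)
open import Data.Nat.Tactic.RingSolver using (solve-∀)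
open import Data.Bool using (Bool; true; false; T; _∧_)
open import Data.Bool.Properties using (T-∧; T-∨)
open import Data.List using (List; []; _∷_; _++_; [_]; length; filter; filterᵇ; applyUpTo)
open import Data.List.Properties using (applyUpTo-∷ʳ; map-upTo; length-++; filter-++; filter-accept; filter-none)
open import Data.List.Relation.Unary.Any as Any using (here)
open import Data.List.Relation.Unary.Any.Properties using (any⁺; any⁻)
open import Data.List.Relation.Unary.All as All using (All; []; _∷_)
open import Data.List.Relation.Unary.All.Properties using (++⁺)
open import Data.List.Membership.Propositional using (_∈_)
open import Data.List.Membership.Propositional.Properties using (∈-++⁺ˡ; ∈-++⁺ʳ; ∈-++⁻; ∈-filter⁺)
open import Data.Product using (∃; _×_; _,_; proj₁; proj₂)
open import Data.Sum using (_⊎_; inj₁; inj₂)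
open import Function using (_∘_)
open import Function.Bundles using (Equivalence)
open import Level using (Level; 0ℓ)
open import Relation.Nullary using (¬_; yes; no; contradiction)
open import Relation.Nullary.Decidable using (T?; _×-dec_; _⊎-dec_)
open import Relation.Unary using (Pred; Decidable; _∪_)
open import Relation.Unary.Properties using (_∪?_)
open import Relation.Binary.PropositionalEquality
  using (_≡_; _≢_; refl; sym; trans; cong; subst; module ≡-Reasoning)

private variable
  ℓ ℓ₁ ℓ₂ : Level

-- count P? u L is the number of i ∈ [u, u + L) satisfying P.  The top point
-- u + L is added last, so induction on L peels off the largest point.
module _ {P : Pred ℕ ℓ} (P? : Decidable P) where

  count : ℕ → ℕ → ℕ
  count u zero = 0
  count u (suc L) with P? (u + L)
  ... | yes _ = suc (count u L)
  ... | no _ = count u L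

module _ {u L : ℕ} where

  below-top : ∀ {i} → i < u + L → i < u + suc L
  below-top i<top = <-≤-trans i<top (+-monoʳ-≤ u (n≤1+n L))

  top< : u + L < u + suc L
  top< = +-monoʳ-< u ≤-refl

count-mono : {P : Pred ℕ ℓ₁} {Q : Pred ℕ ℓ₂} (P? : Decidable P) (Q? : Decidable Q) → ∀ {u} L →
  (∀ {i} → u ≤ i → i < u + L → P i → Q i) → count P? u L ≤ count Q? u L
count-mono P? Q? zero P⇒Q = z≤n
count-mono P? Q? {u} (suc L) P⇒Q with P? (u + L) | Q? (u + L)
... | yes _ | yes _ = s≤s (count-mono P? Q? L λ u≤i i<top → P⇒Q u≤i (below-top i<top))
... | yes p | no ¬q = contradiction (P⇒Q (m≤m+n u L) top< p) ¬q
... | no _  | yes _ = m≤n⇒m≤1+n (count-mono P? Q? L λ u≤i i<top → P⇒Q u≤i (below-top i<top))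
... | no _  | no _  = count-mono P? Q? L λ u≤i i<top → P⇒Q u≤i (below-top i<top)

count-∪ : {P : Pred ℕ ℓ₁} {Q : Pred ℕ ℓ₂} (P? : Decidable P) (Q? : Decidable Q) → ∀ u L →
  count (P? ∪? Q?) u L ≤ count P? u L + count Q? u L
count-∪ P? Q? u zero = z≤n
count-∪ P? Q? u (suc L) with P? (u + L) | Q? (u + L) | count-∪ P? Q? u L
... | yes _ | yes _ | ih = s≤s (≤-trans ih (+-monoʳ-≤ (count P? u L) (n≤1+n _)))
... | yes _ | no _  | ih = s≤s ih
... | no _  | yes _ | ih = ≤-trans (s≤s ih) (≤-reflexive (sym (+-suc _ _)))
... | no _  | no _  | ih = ih

count-interval : {P : Pred ℕ ℓ} (P? : Decidable P) → ∀ {u} L {lo hi} →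
  (∀ {i} → i < u + L → P i → lo ≤ i × i < hi) → count P? u L ≤ hi ∸ lo
count-interval P? zero inside = z≤n
count-interval P? {u} (suc L) {lo} {hi} inside with P? (u + L)
... | no _ = count-interval P? L λ i<top → inside (below-top i<top)
... | yes p = begin
    suc (count P? u L)  ≤⟨ s≤s (count-interval P? L λ i<top pi → proj₁ (inside (below-top i<top) pi) , i<top) ⟩
    suc (u + L ∸ lo)    ≡⟨ sym (+-∸-assoc 1 lo≤top) ⟩
    suc (u + L) ∸ lo    ≤⟨ ∸-monoˡ-≤ lo top<hi ⟩
    hi ∸ lo             ∎
  where
  open ≤-Reasoning
  lo≤top : lo ≤ u + L
  lo≤top = proj₁ (inside top< p)
  top<hi : u + L < hi
  top<hi = proj₂ (inside top< p)

count-empty : {P : Pred ℕ ℓ} (P? : Decidable P) → ∀ {u} L →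
  (∀ {i} → i < u + L → ¬ P i) → count P? u L ≡ 0
count-empty P? zero none = refl
count-empty P? {u} (suc L) none with P? (u + L)
... | yes p = contradiction p (none top<)
... | no _ = count-empty P? L λ i<top → none (below-top i<top)

count-atMostOne : {P : Pred ℕ ℓ} (P? : Decidable P) → ∀ {u} L →
  (∀ {i j} → P i → P j → i ≡ j) → count P? u L ≤ 1
count-atMostOne P? zero unique = z≤n
count-atMostOne P? {u} (suc L) unique with P? (u + L)
... | yes p = s≤s (≤-reflexive (count-empty P? L λ i<top pi → <-irrefl (unique pi p) i<top))
... | no _ = count-atMostOne P? L unique

length-filter-upTo : {P : Pred ℕ ℓ} (P? : Decidable P) → ∀ u L →
  length (filter P? (applyUpTo (u +_) L)) ≡ count P? u L
length-filter-upTo P? u zero = refl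
length-filter-upTo P? u (suc L) = begin
    length (filter P? (applyUpTo (u +_) (suc L)))
  ≡⟨ cong (length ∘ filter P?) (sym (applyUpTo-∷ʳ (u +_) L)) ⟩
    length (filter P? (xs ++ [ u + L ]))
  ≡⟨ cong length (filter-++ P? xs [ u + L ]) ⟩
    length (filter P? xs ++ filter P? [ u + L ])
  ≡⟨ length-++ (filter P? xs) ⟩
    length (filter P? xs) + length (filter P? [ u + L ])
  ≡⟨ cong (_+ length (filter P? [ u + L ])) (length-filter-upTo P? u L) ⟩
    count P? u L + length (filter P? [ u + L ])
  ≡⟨ add-top ⟩
    count P? u (suc L)
  ∎
  where
  open ≡-Reasoning
  xs : List ℕ
  xs = applyUpTo (u +_) L
  add-top : count P? u L + length (filter P? [ u + L ]) ≡ count P? u (suc L)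
  add-top with P? (u + L)
  ... | yes _ = +-comm (count P? u L) 1
  ... | no _ = +-identityʳ (count P? u L)

least : {P : Pred ℕ ℓ} → Decidable P → ∀ {k} → P k →
  ∃ λ j → P j × j ≤ k × (∀ {i} → i < j → ¬ P i)
least {P = P} P? {k} = <-rec Least search k
  where
  Least : ℕ → Set _
  Least k = P k → ∃ λ j → P j × j ≤ k × (∀ {i} → i < j → ¬ P i)
  search : ∀ k → (∀ {j} → j < k → Least j) → Least k
  search k smaller pk with anyUpTo? P? k
  ... | no none = k , pk , ≤-refl , λ i<k pi → none (_ , i<k , pi)
  ... | yes (j , j<k , pj) with smaller j<k pj
  ...   | i , pi , i≤j , minimal = i , pi , ≤-trans i≤j (<⇒≤ j<k) , minimal

Window : ℕ → ℕ → ℕ → Set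
Window n y x = suc x ≡ y ⊎ (x + n ≤ y × y ≤ x + 2 * n)

window? : ∀ n y → Decidable (Window n y)
window? n y x = (suc x ≟ y) ⊎-dec (x + n ≤? y ×-dec y ≤? x + 2 * n)

Sparse : ℕ → ℕ → Pred ℕ ℓ → Set ℓ
Sparse n a S = ∀ {y x₁ x₂} → S y →
  a ≤ x₁ → S x₁ → Window n y x₁ → a ≤ x₂ → S x₂ → Window n y x₂ → x₁ ≡ x₂

-- The final arithmetic: when a₁ ≤ y < a₁ + n and y < a + 3n, the bound
-- (a₁ − 2n − a) + (y − a₁ + 1) + 1 is at most n + 1.  If a₁ < a + 2n the first
-- term vanishes and y − a₁ < n; otherwise the sum telescopes to y − 2n − a + 2.
budget : ∀ {n a a₁ y} → a₁ ≤ y → y < a₁ + n → y < a + 3 * n →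
  (a₁ ∸ 2 * n) ∸ a + (suc (y ∸ a₁) + 1) ≤ n + 1
budget {n} {a} {a₁} {y} a₁≤y y<a₁+n y<a+3n with a + 2 * n ≤? a₁
... | no a+2n≰a₁ = begin
      low + (suc (y ∸ a₁) + 1)  ≡⟨ cong (_+ (suc (y ∸ a₁) + 1)) low≡0 ⟩
      suc (y ∸ a₁) + 1          ≤⟨ +-monoˡ-≤ 1 gap<n ⟩
      n + 1                     ∎
  where
  open ≤-Reasoning
  low : ℕ
  low = (a₁ ∸ 2 * n) ∸ a
  low≡0 : low ≡ 0
  low≡0 = m≤n⇒m∸n≡0 (m≤n+o⇒m∸n≤o a₁ (2 * n)
            (≤-trans (<⇒≤ (≰⇒> a+2n≰a₁)) (≤-reflexive (+-comm a (2 * n)))))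
  gap<n : suc (y ∸ a₁) ≤ n
  gap<n = ≤-trans (≤-reflexive (sym (+-∸-assoc 1 a₁≤y))) (m≤n+o⇒m∸n≤o (suc y) a₁ y<a₁+n)
... | yes a+2n≤a₁ = +-cancelʳ-≤ (a + 2 * n) _ _ (begin
      (low + (suc gap + 1)) + (a + 2 * n)  ≡⟨ regroup low gap a (2 * n) ⟩
      ((low + a) + 2 * n + gap) + 2        ≡⟨ cong (λ z → (z + 2 * n + gap) + 2) (m∸n+n≡m a≤a₁∸2n) ⟩
      ((a₁ ∸ 2 * n) + 2 * n + gap) + 2     ≡⟨ cong (λ z → (z + gap) + 2) (m∸n+n≡m 2n≤a₁) ⟩
      (a₁ + gap) + 2                       ≡⟨ cong (_+ 2) (m+[n∸m]≡n a₁≤y) ⟩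
      y + 2                                ≡⟨ +-suc y 1 ⟩
      suc y + 1                            ≤⟨ +-monoˡ-≤ 1 y<a+3n ⟩
      (a + 3 * n) + 1                      ≡⟨ split-3n a n ⟩
      (n + 1) + (a + 2 * n)                ∎)
  where
  open ≤-Reasoning
  low gap : ℕ
  low = (a₁ ∸ 2 * n) ∸ a
  gap = y ∸ a₁
  a≤a₁∸2n : a ≤ a₁ ∸ 2 * n
  a≤a₁∸2n = m+n≤o⇒m≤o∸n a a+2n≤a₁
  2n≤a₁ : 2 * n ≤ a₁
  2n≤a₁ = ≤-trans (m≤n+m (2 * n) a) a+2n≤a₁
  regroup : ∀ l g a m → (l + (suc g + 1)) + (a + m) ≡ ((l + a) + m + g) + 2
  regroup = solve-∀
  split-3n : ∀ a n → (a + 3 * n) + 1 ≡ (n + 1) + (a + 2 * n)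
  split-3n = solve-∀

module SparseCount {n : ℕ} (n>0 : 0 < n) {S : Pred ℕ ℓ} (S? : Decidable S)
                   {a : ℕ} (sparse : Sparse n a S) where

  Near : ℕ → Pred ℕ ℓ
  Near c i = a ≤ i × S i × Window n c i

  near? : ∀ c → Decidable (Near c)
  near? c i = a ≤? i ×-dec S? i ×-dec window? n c i

  near-unique : ∀ {c} → S c → ∀ {i j} → Near c i → Near c j → i ≡ j
  near-unique Sc (a≤i , Si , wi) (a≤j , Sj , wj) = sparse Sc a≤i Si wi a≤j Sj wj

  -- y = a + m is the largest point of S counted, and a₁ the least point of S
  -- with y < a₁ + n, so every point of S below a₁ is at most y − n.
  module Block (m a₁ : ℕ) (Sy : S (a + m)) (Sa₁ : S a₁) (a₁≤y : a₁ ≤ a + m)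
               (y<a₁+n : a + m < a₁ + n) (below-a₁ : ∀ {i} → i < a₁ → S i → i + n ≤ a + m) where

    y : ℕ
    y = a + m

    Low Top Apex : Pred ℕ 0ℓ
    Low i = a ≤ i × i < a₁ ∸ 2 * n
    Top i = a₁ ≤ i × i < y ∸ 1
    Apex i = i ≡ y

    low? : Decidable Low
    low? i = a ≤? i ×-dec i <? a₁ ∸ 2 * n
    top? : Decidable Top
    top? i = a₁ ≤? i ×-dec i <? y ∸ 1
    apex? : Decidable Apex
    apex? i = i ≟ y

    Cover : Pred ℕ ℓ
    Cover = Low ∪ ((Near a₁ ∪ Near y) ∪ (Top ∪ Apex))

    windows? : Decidable (Near a₁ ∪ Near y)
    windows? = near? a₁ ∪? near? y
    upper? : Decidable (Top ∪ Apex)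
    upper? = top? ∪? apex?
    cover? : Decidable Cover
    cover? = low? ∪? (windows? ∪? upper?)

    classify : ∀ {i} → a ≤ i → i ≤ y → S i → Cover i
    classify {i} a≤i i≤y Si with i + n ≤? y
    ... | no i+n≰y = inj₂ (upper (≮⇒≥ λ i<a₁ → i+n≰y (below-a₁ i<a₁ Si)))
      where
      upper : a₁ ≤ i → ((Near a₁ ∪ Near y) ∪ (Top ∪ Apex)) i
      upper a₁≤i with m≤n⇒m<n∨m≡n i≤y
      ... | inj₂ i≡y = inj₂ (inj₂ i≡y)
      ... | inj₁ i<y with m≤n⇒m<n∨m≡n i<y
      ...   | inj₂ 1+i≡y = inj₁ (inj₂ (a≤i , Si , inj₁ 1+i≡y))
      ...   | inj₁ 1+i<y = inj₂ (inj₁ (a₁≤i , m+n≤o⇒m≤o∸n (suc i) (≤-trans (≤-reflexive (+-comm (suc i) 1)) 1+i<y)))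
    ... | yes i+n≤y with y ≤? i + 2 * n
    ...   | yes y≤i+2n = inj₂ (inj₁ (inj₂ (a≤i , Si , inj₂ (i+n≤y , y≤i+2n))))
    ...   | no y≰i+2n with a₁ ≤? i + 2 * n
    ...     | yes a₁≤i+2n = inj₂ (inj₁ (inj₁ (a≤i , Si , inj₂ (<⇒≤ i+n<a₁ , a₁≤i+2n))))
      where
      i+n<a₁ : i + n < a₁
      i+n<a₁ = +-cancelʳ-< n (i + n) a₁ (begin-strict
        i + n + n    ≡⟨ +-assoc i n n ⟩
        i + (n + n)  ≡⟨ cong (λ z → i + (n + z)) (sym (+-identityʳ n)) ⟩
        i + 2 * n    <⟨ ≰⇒> y≰i+2n ⟩
        y            <⟨ y<a₁+n ⟩
        a₁ + n       ∎)
        where open ≤-Reasoning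
    ...     | no a₁≰i+2n = inj₁ (a≤i , m+n≤o⇒m≤o∸n (suc i) (≰⇒> a₁≰i+2n))

    -- The two windows and the top interval together hold at most y − a₁ + 1
    -- points: if a₁ = y the windows coincide and the top interval is empty,
    -- otherwise each window holds one point and the top interval y − a₁ − 1.
    windows-top : ∀ L → count windows? a L + count top? a L ≤ suc (y ∸ a₁)
    windows-top L with m≤n⇒m<n∨m≡n a₁≤y
    ... | inj₂ a₁≡y = +-mono-≤ one-window no-top
      where
      in-window-y : ∀ {i} → (Near a₁ ∪ Near y) i → Near y i
      in-window-y (inj₁ near-a₁) = subst (λ c → Near c _) a₁≡y near-a₁
      in-window-y (inj₂ near-y) = near-y
      one-window : count windows? a L ≤ 1
      one-window = count-atMostOne windows? L λ wi wj → near-unique Sy (in-window-y wi) (in-window-y wj)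
      no-top : count top? a L ≤ y ∸ a₁
      no-top = ≤-trans (count-interval top? L λ _ t → t) (≤-reflexive (begin-equality
        y ∸ 1 ∸ a₁   ≡⟨ cong (λ c → y ∸ 1 ∸ c) a₁≡y ⟩
        y ∸ 1 ∸ y    ≡⟨ m≤n⇒m∸n≡0 (m∸n≤m y 1) ⟩
        0            ≡⟨ sym (n∸n≡0 y) ⟩
        y ∸ y        ≡⟨ cong (y ∸_) (sym a₁≡y) ⟩
        y ∸ a₁       ∎))
        where open ≤-Reasoning
    ... | inj₁ a₁<y = begin
        count windows? a L + count top? a L
      ≤⟨ +-mono-≤ (count-∪ (near? a₁) (near? y) a L) (count-interval top? L λ _ t → t) ⟩
        (count (near? a₁) a L + count (near? y) a L) + (y ∸ 1 ∸ a₁)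
      ≤⟨ +-monoˡ-≤ _ (+-mono-≤ (count-atMostOne (near? a₁) L (near-unique Sa₁))
                                (count-atMostOne (near? y) L (near-unique Sy))) ⟩
        2 + (y ∸ 1 ∸ a₁)
      ≡⟨ cong (2 +_) (∸-+-assoc y 1 a₁) ⟩
        suc (suc (y ∸ suc a₁))
      ≡⟨ cong suc (sym (+-∸-assoc 1 a₁<y)) ⟩
        suc (y ∸ a₁)
      ∎
      where open ≤-Reasoning

    bound : y < a + 3 * n → count S? a (suc m) ≤ n + 1
    bound y<a+3n = begin
        count S? a (suc m)
      ≤⟨ count-mono S? cover? (suc m) (λ a≤i i<top → classify a≤i (≤-pred (≤-trans i<top (≤-reflexive (+-suc a m))))) ⟩
        count cover? a (suc m)
      ≤⟨ count-∪ low? _ a (suc m) ⟩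
        count low? a (suc m) + count (windows? ∪? upper?) a (suc m)
      ≤⟨ +-mono-≤ (count-interval low? (suc m) λ _ l → l)
                  (≤-trans (count-∪ windows? upper? a (suc m)) (+-monoʳ-≤ _ (count-∪ top? apex? a (suc m)))) ⟩
        (a₁ ∸ 2 * n) ∸ a + (cW + (cT + cA))
      ≡⟨ cong ((a₁ ∸ 2 * n) ∸ a +_) (sym (+-assoc cW cT cA)) ⟩
        (a₁ ∸ 2 * n) ∸ a + ((cW + cT) + cA)
      ≤⟨ +-monoʳ-≤ _ (+-mono-≤ (windows-top (suc m)) (count-atMostOne apex? {a} (suc m) λ i≡y j≡y → trans i≡y (sym j≡y))) ⟩
        (a₁ ∸ 2 * n) ∸ a + (suc (y ∸ a₁) + 1)
      ≤⟨ budget {a = a} a₁≤y y<a₁+n y<a+3n ⟩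
        n + 1
      ∎
      where
      open ≤-Reasoning
      cW cT cA : ℕ
      cW = count windows? a (suc m)
      cT = count top? a (suc m)
      cA = count apex? a (suc m)

  top-bound : ∀ m → S (a + m) → a + m < a + 3 * n → count S? a (suc m) ≤ n + 1
  top-bound m Sy y<a+3n with least (λ i → S? i ×-dec a + m <? i + n) (Sy , m<m+n (a + m) n>0)
  ... | a₁ , (Sa₁ , y<a₁+n) , a₁≤y , minimal = Block.bound m a₁ Sy Sa₁ a₁≤y y<a₁+n below y<a+3n
    where
    below : ∀ {i} → i < a₁ → S i → i + n ≤ a + m
    below i<a₁ Si = ≮⇒≥ λ y<i+n → minimal i<a₁ (Si , y<i+n)

  sparse-count : ∀ L → L ≤ 3 * n → count S? a L ≤ n + 1
  sparse-count zero _ = z≤n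
  sparse-count (suc m) m<3n with S? (a + m) | top-bound m
  ... | yes Sy | bound-at-top = bound-at-top Sy (+-monoʳ-< a m<3n)
  ... | no _   | _ = sparse-count m (<⇒≤ m<3n)

Ulam : ℕ → Pred ℕ 0ℓ
Ulam n k = T (isUlam n k)

ulam? : ∀ n → Decidable (Ulam n)
ulam? n k = T? (isUlam n k)

mem→∈ : ∀ {k} xs → T (memᵇ k xs) → k ∈ xs
mem→∈ {k} xs t = Any.map (λ {x} x≡ᵇk → sym (≡ᵇ⇒≡ x k x≡ᵇk)) (any⁻ _ xs t)

∈→mem : ∀ {k xs} → k ∈ xs → T (memᵇ k xs)
∈→mem {k} k∈xs = any⁺ _ (Any.map (λ { refl → ≡⇒≡ᵇ k k refl }) k∈xs)

newTerm-cases : ∀ n xs k → T (isNewTerm n xs k) → k ≡ 1 ⊎ k ≡ n ⊎ (n < k × reps xs k ≡ 1)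
newTerm-cases n xs k new with Equivalence.to (T-∨ {k ≡ᵇ 1}) new
... | inj₁ k≡ᵇ1 = inj₁ (≡ᵇ⇒≡ k 1 k≡ᵇ1)
... | inj₂ new′ with Equivalence.to (T-∨ {k ≡ᵇ n}) new′
...   | inj₁ k≡ᵇn = inj₂ (inj₁ (≡ᵇ⇒≡ k n k≡ᵇn))
...   | inj₂ new″ with Equivalence.to (T-∧ {n <ᵇ k}) new″
...     | n<ᵇk , reps≡ᵇ1 = inj₂ (inj₂ (<ᵇ⇒< n k n<ᵇk , ≡ᵇ⇒≡ (reps xs k) 1 reps≡ᵇ1))

newTerm-self : ∀ n xs → T (isNewTerm n xs n)
newTerm-self n xs = Equivalence.from (T-∨ {n ≡ᵇ 1})
  (inj₂ (Equivalence.from (T-∨ {n ≡ᵇ n}) (inj₁ (≡⇒≡ᵇ n n refl))))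

newTerm-unique : ∀ n xs k → n < k → reps xs k ≡ 1 → T (isNewTerm n xs k)
newTerm-unique n xs k n<k reps≡1 = Equivalence.from (T-∨ {k ≡ᵇ 1}) (inj₂ (Equivalence.from (T-∨ {k ≡ᵇ n})
  (inj₂ (Equivalence.from (T-∧ {n <ᵇ k}) (<⇒<ᵇ n<k , ≡⇒≡ᵇ (reps xs k) 1 reps≡1)))))

newTerm-≥ : ∀ {n xs k} → 1 < k → T (isNewTerm n xs k) → n ≤ k
newTerm-≥ {n} {xs} {k} 1<k new with newTerm-cases n xs k new
... | inj₁ k≡1 = contradiction k≡1 (>⇒≢ 1<k)
... | inj₂ (inj₁ k≡n) = ≤-reflexive (sym k≡n)
... | inj₂ (inj₂ (n<k , _)) = <⇒≤ n<k

∈-step : ∀ {n xs k x} → x ∈ step n xs k → x ∈ xs ⊎ (x ≡ k × T (isNewTerm n xs k))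
∈-step {n} {xs} {k} x∈ with isNewTerm n xs k
... | false = inj₁ x∈
... | true with ∈-++⁻ xs x∈
...   | inj₁ x∈xs = inj₁ x∈xs
...   | inj₂ (here x≡k) = inj₂ (x≡k , _)

step-keeps : ∀ {n xs k x} → x ∈ xs → x ∈ step n xs k
step-keeps {n} {xs} {k} x∈ with isNewTerm n xs k
... | false = x∈
... | true = ∈-++⁺ˡ x∈

step-adds : ∀ {n xs k} → T (isNewTerm n xs k) → k ∈ step n xs k
step-adds {n} {xs} {k} new with isNewTerm n xs k
... | true = ∈-++⁺ʳ xs (here refl)

ulam-bounded : ∀ {n m x} → x ∈ ulamUpTo n m → x ≤ m
ulam-bounded {n} {suc m} x∈ with ∈-step {n} {ulamUpTo n m} {suc m} x∈
... | inj₁ x∈prev = m≤n⇒m≤1+n (ulam-bounded x∈prev)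
... | inj₂ (refl , _) = ≤-refl

ulam-grows : ∀ {n m m′ x} → x ∈ ulamUpTo n m → m ≤ m′ → x ∈ ulamUpTo n m′
ulam-grows {m′ = zero} x∈ z≤n = x∈
ulam-grows {n} {m′ = suc m′} x∈ m≤1+m′ with m≤n⇒m<n∨m≡n m≤1+m′
... | inj₁ (s≤s m≤m′) = step-keeps {n} {ulamUpTo n m′} {suc m′} (ulam-grows x∈ m≤m′)
... | inj₂ refl = x∈

ulam-mem : ∀ {n k m} → Ulam n k → k ≤ m → k ∈ ulamUpTo n m
ulam-mem {n} {k} uk k≤m = ulam-grows {n} (mem→∈ (ulamUpTo n k) uk) k≤m

newTerm→ulam : ∀ n m → T (isNewTerm n (ulamUpTo n m) (suc m)) → Ulam n (suc m)
newTerm→ulam n m new = ∈→mem (step-adds {n} {ulamUpTo n m} {suc m} new)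

unique-rep : ∀ {n m} → 0 < m → n < suc m → Ulam n (suc m) → reps (ulamUpTo n m) (suc m) ≡ 1
unique-rep {n} {m} 0<m n<y uy with ∈-step {n} {ulamUpTo n m} {suc m} (mem→∈ (ulamUpTo n (suc m)) uy)
... | inj₁ y∈prev = contradiction (ulam-bounded y∈prev) (<-irrefl refl)
... | inj₂ (_ , new) with newTerm-cases n (ulamUpTo n m) (suc m) new
...   | inj₁ y≡1 = contradiction (suc-injective y≡1) (>⇒≢ 0<m)
...   | inj₂ (inj₁ y≡n) = contradiction (sym y≡n) (<⇒≢ n<y)
...   | inj₂ (inj₂ (_ , reps≡1)) = reps≡1

step-shape : ∀ {n rest k} → All (n ≤_) rest → 1 < k →
  ∃ λ rest′ → step n (1 ∷ rest) k ≡ 1 ∷ rest′ × All (n ≤_) rest′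
step-shape {n} {rest} {k} rest≥n 1<k with isNewTerm n (1 ∷ rest) k in new
... | false = rest , refl , rest≥n
... | true = rest ++ [ k ] , refl , ++⁺ rest≥n (newTerm-≥ {n} {1 ∷ rest} 1<k (subst T (sym new) _) ∷ [])

shape : ∀ n m → ∃ λ rest → ulamUpTo n (suc m) ≡ 1 ∷ rest × All (n ≤_) rest
shape n zero = [] , refl , []
shape n (suc m) with shape n m
... | rest , eq , rest≥n rewrite eq = step-shape rest≥n (s≤s (s≤s z≤n))

smallerPart : List ℕ → ℕ → ℕ → Bool
smallerPart xs k u = (u <ᵇ (k ∸ u)) ∧ memᵇ (k ∸ u) xs

-- Up to 2n, a list made of 1 and numbers ≥ n offers only the part 1.
reps-small : ∀ {n s rest} → All (n ≤_) rest → s ≤ 2 * n →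
  T (smallerPart (1 ∷ rest) s 1) → reps (1 ∷ rest) s ≡ 1
reps-small {n} {s} {rest} rest≥n s≤2n part₁ = cong length (begin
    filterᵇ (smallerPart xs s) xs          ≡⟨ filter-accept (T? ∘ smallerPart xs s) part₁ ⟩
    1 ∷ filterᵇ (smallerPart xs s) rest    ≡⟨ cong (1 ∷_) (filter-none (T? ∘ smallerPart xs s) (All.map no-part rest≥n)) ⟩
    1 ∷ []                                 ∎)
  where
  open ≡-Reasoning
  xs : List ℕ
  xs = 1 ∷ rest
  no-part : ∀ {u} → n ≤ u → ¬ T (smallerPart xs s u)
  no-part {u} n≤u part = <-irrefl refl (<-≤-trans u<s∸u s∸u≤u)
    where
    u<s∸u : u < s ∸ u
    u<s∸u = <ᵇ⇒< u (s ∸ u) (proj₁ (Equivalence.to T-∧ part))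
    s∸u≤u : s ∸ u ≤ u
    s∸u≤u = ≤-trans (∸-mono s≤2n n≤u) (≤-trans (≤-reflexive (trans (m+n∸m≡n n (n + 0)) (+-identityʳ n))) n≤u)

-- For n ≤ m < 2n with m a term, m + 1 = 1 + m is the unique representation.
reps-below-2n : ∀ {n m} → 2 ≤ n → n ≤ m → suc m ≤ 2 * n → Ulam n m → reps (ulamUpTo n m) (suc m) ≡ 1
reps-below-2n {m = zero} 2≤n n≤0 _ _ with ≤-trans 2≤n n≤0
... | ()
reps-below-2n {n} {suc m} 2≤n n≤m y≤2n um with shape n m
... | rest , eq , rest≥n = subst (λ xs → reps xs (2 + m) ≡ 1) (sym eq) (reps-small rest≥n y≤2n part₁)
  where
  part₁ : T (smallerPart (1 ∷ rest) (2 + m) 1)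
  part₁ = Equivalence.from T-∧ (<⇒<ᵇ (≤-trans 2≤n n≤m) , ∈→mem (subst (suc m ∈_) eq (ulam-mem um ≤-refl)))

small-term : ∀ {n} → 2 ≤ n → ∀ {k} → n ≤ k → k ≤ 2 * n → Ulam n k
small-term 2≤n {zero} n≤0 _ with ≤-trans 2≤n n≤0
... | ()
small-term {n} 2≤n {suc m} n≤k k≤2n with m≤n⇒m<n∨m≡n n≤k
... | inj₂ refl = newTerm→ulam n m (newTerm-self n (ulamUpTo n m))
... | inj₁ (s≤s n≤m) = newTerm→ulam n m (newTerm-unique n (ulamUpTo n m) (suc m) (s≤s n≤m)
        (reps-below-2n 2≤n n≤m k≤2n (small-term 2≤n n≤m (≤-trans (n≤1+n m) k≤2n))))

two-members : ∀ {A : Set} {xs : List A} {u v} → u ∈ xs → v ∈ xs → u ≢ v → 2 ≤ length xs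
two-members {xs = _ ∷ _ ∷ _} _ _ _ = s≤s (s≤s z≤n)
two-members {xs = _ ∷ []} (here refl) (here refl) u≢v = contradiction refl u≢v

reps≥2 : ∀ {xs k u v} → u ∈ xs → v ∈ xs → u ≢ v →
  T (smallerPart xs k u) → T (smallerPart xs k v) → 2 ≤ reps xs k
reps≥2 {xs} {k} u∈ v∈ u≢v part-u part-v =
  two-members (∈-filter⁺ (T? ∘ smallerPart xs k) u∈ part-u) (∈-filter⁺ (T? ∘ smallerPart xs k) v∈ part-v) u≢v

window-gap : ∀ {n y x} → 2 ≤ n → Window n y x → x < y × y ∸ x ≤ 2 * n × Ulam n (y ∸ x)
window-gap {n} {x = x} 2≤n (inj₁ refl) rewrite m+n∸n≡m 1 x =
  ≤-refl , ≤-trans (≤-trans (s≤s z≤n) 2≤n) (m≤m+n n (n + 0)) , _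
window-gap {n} {y} {x} 2≤n (inj₂ (x+n≤y , y≤x+2n)) =
  <-≤-trans (m<m+n x (≤-trans (s≤s z≤n) 2≤n)) x+n≤y , gap≤2n , small-term 2≤n n≤gap gap≤2n
  where
  n≤gap : n ≤ y ∸ x
  n≤gap = m+n≤o⇒m≤o∸n n (≤-trans (≤-reflexive (+-comm n x)) x+n≤y)
  gap≤2n : y ∸ x ≤ 2 * n
  gap≤2n = m≤n+o⇒m∸n≤o y x y≤x+2n

window-rep : ∀ {n m x} → 2 ≤ n → 2 * n < x → Ulam n x → Window n (suc m) x →
  (suc m ∸ x) ∈ ulamUpTo n m × T (smallerPart (ulamUpTo n m) (suc m) (suc m ∸ x))
window-rep {n} {m} {x} 2≤n 2n<x ux w = ulam-mem ugap gap≤m , part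
  where
  gap : ℕ
  gap = suc m ∸ x
  x<y : x < suc m
  x<y = proj₁ (window-gap 2≤n w)
  gap<x : gap < x
  gap<x = ≤-<-trans (proj₁ (proj₂ (window-gap 2≤n w))) 2n<x
  ugap : Ulam n gap
  ugap = proj₂ (proj₂ (window-gap 2≤n w))
  gap≤m : gap ≤ m
  gap≤m = ≤-trans (<⇒≤ gap<x) (≤-pred x<y)
  part : T (smallerPart (ulamUpTo n m) (suc m) gap)
  part = subst (λ z → T ((gap <ᵇ z) ∧ memᵇ z (ulamUpTo n m))) (sym (m∸[m∸n]≡n (<⇒≤ x<y)))
    (Equivalence.from (T-∧ {gap <ᵇ x}) (<⇒<ᵇ gap<x , ∈→mem (ulam-mem {n} ux (≤-pred x<y))))

ulam-sparse : ∀ {n a} → 2 ≤ n → 2 * n < a → Sparse n a (Ulam n)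
ulam-sparse 2≤n 2n<a {zero} _ _ _ w₁ _ _ _ with proj₁ (window-gap 2≤n w₁)
... | ()
ulam-sparse {n} 2≤n 2n<a {suc m} {x₁} {x₂} uy a≤x₁ ux₁ w₁ a≤x₂ ux₂ w₂ with x₁ ≟ x₂
... | yes x₁≡x₂ = x₁≡x₂
... | no x₁≢x₂ = contradiction (unique-rep 0<m n<y uy) (>⇒≢ two-reps)
  where
  2n<x₁ : 2 * n < x₁
  2n<x₁ = <-≤-trans 2n<a a≤x₁
  2n<x₂ : 2 * n < x₂
  2n<x₂ = <-≤-trans 2n<a a≤x₂
  x₁<y : x₁ < suc m
  x₁<y = proj₁ (window-gap 2≤n w₁)
  x₂<y : x₂ < suc m
  x₂<y = proj₁ (window-gap 2≤n w₂)
  n<x₁ : n < x₁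
  n<x₁ = ≤-<-trans (m≤m+n n (n + 0)) 2n<x₁
  0<m : 0 < m
  0<m = ≤-trans (s≤s z≤n) (≤-trans n<x₁ (≤-pred x₁<y))
  n<y : n < suc m
  n<y = <-trans n<x₁ x₁<y
  two-reps : 2 ≤ reps (ulamUpTo n m) (suc m)
  two-reps with window-rep 2≤n 2n<x₁ ux₁ w₁ | window-rep 2≤n 2n<x₂ ux₂ w₂
  ... | gap₁∈ , part₁ | gap₂∈ , part₂ =
    reps≥2 gap₁∈ gap₂∈ (λ gaps≡ → x₁≢x₂ (∸-cancelˡ-≡ (<⇒≤ x₁<y) (<⇒≤ x₂<y) gaps≡)) part₁ part₂

countUlamIn-count : ∀ n a L → countUlamIn n a L ≡ count (ulam? n) a L
countUlamIn-count n a L =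
  trans (cong (length ∘ filterᵇ (isUlam n)) (map-upTo (a +_) L)) (length-filter-upTo (ulam? n) a L)

theorem4p4 : (n : ℕ) → 2 ≤ n → (a : ℕ) → 2 * n + 2 < a →
    countUlamIn n a (3 * n) ≤ n + 1
theorem4p4 n 2≤n a 2n+2<a = begin
    countUlamIn n a (3 * n)    ≡⟨ countUlamIn-count n a (3 * n) ⟩
    count (ulam? n) a (3 * n)  ≤⟨ SparseCount.sparse-count 0<n (ulam? n) (ulam-sparse 2≤n 2n<a) (3 * n) ≤-refl ⟩
    n + 1                      ∎
  where
  open ≤-Reasoning
  0<n : 0 < n
  0<n = ≤-trans (s≤s z≤n) 2≤n
  2n<a : 2 * n < a
  2n<a = ≤-<-trans (m≤m+n (2 * n) 2) 2n+2<a
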